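{- Let $\Delta$ be a pure simplicial complex on vertex set $[n]$ with codimension $c=n-\dim\Delta-1$, and let $v$ be a vertex of $\Delta$. If $\overline{e}(\Delta)\le 2c-1$ and $b$ is the codimension of $\mathrm{link}_\Delta(v)$, then $\overline{e}(\mathrm{link}_\Delta(v))\le 2b-1$.
   Context: A simplicial complex on vertex set $[n]$ contains $\{i\}$ as a face for every $i\in[n]$. $\Delta$ is pure if all facets have the same cardinality; $\dim F=|F|-1$. $\mathrm{link}_\Delta(v)=\{G\in\Delta : v\notin G,\ G\cup\{v\}\in\Delta\}$, regarded as a simplicial complex on its own vertex set (the vertices $w$ with $\{w\}\in\mathrm{link}_\Delta(v)$). For a simplicial complex $\Gamma$ with vertex set $V$, its codimension is $|V|-\dim\Gamma-1$, an antifacet of $\Gamma$ is a subset of $V$ of cardinality $\dim\Gamma+1$ that is not a face of $\Gamma$, and $\overline{e}(\Gamma)$ denotes the number of antifacets of $\Gamma$. -}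

module Defs where

open import Data.Bool using (Bool; true; false; T; if_then_else_; not; _∧_)
open import Data.Nat using (ℕ; zero; suc; _⊔_; _∸_; _≟_)
open import Data.Fin using (Fin)
open import Data.Fin.Subset using (Subset; _⊆_; ∣_∣; ⁅_⁆; _∪_; inside; outside)
open import Data.Fin.Subset.Properties using (_⊆?_)
open import Data.List using (List; []; _∷_; map; _++_; foldr)
open import Data.Vec using (Vec; tabulate; lookup) renaming (_∷_ to _∷ᵛ_; [] to []ᵛ)
open import Data.Product using (_×_)
open import Relation.Nullary.Decidable using (⌊_⌋)
open import Relation.Binary.PropositionalEquality using (_≡_)

SetFamily : ℕ → Set
SetFamily n = Subset n → Bool

DownClosed : ∀ {n} → SetFamily n → Set
DownClosed {n} Γ = ∀ (F G : Subset n) → G ⊆ F → T (Γ F) → T (Γ G)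

record SimplicialComplex (n : ℕ) : Set where
  field
    face       : SetFamily n
    downClosed : DownClosed face
    singletons : ∀ (i : Fin n) → T (face ⁅ i ⁆)
open SimplicialComplex public

subsets : (n : ℕ) → List (Subset n)
subsets zero    = []ᵛ ∷ []
subsets (suc n) = map (outside ∷ᵛ_) (subsets n) ++ map (inside ∷ᵛ_) (subsets n)

countB : ∀ {A : Set} → (A → Bool) → List A → ℕ
countB p = foldr (λ x k → if p x then suc k else k) 0

Facet : ∀ {n} → SetFamily n → Subset n → Set
Facet {n} Γ F = T (Γ F) × (∀ (G : Subset n) → T (Γ G) → F ⊆ G → F ≡ G)

Pure : ∀ {n} → SetFamily n → Set
Pure {n} Γ = ∀ (F G : Subset n) → Facet Γ F → Facet Γ G → ∣ F ∣ ≡ ∣ G ∣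

-- rank Γ = dim Γ + 1 = the largest cardinality of a face
-- (using rank avoids dim = -1 for the complex {∅}).
rank : ∀ {n} → SetFamily n → ℕ
rank {n} Γ = foldr (λ F m → if Γ F then ∣ F ∣ ⊔ m else m) 0 (subsets n)

vertexSet : ∀ {n} → SetFamily n → Subset n
vertexSet Γ = tabulate (λ w → Γ ⁅ w ⁆)

-- codimension = |V| - dim Γ - 1 = |V| - rank Γ.
codim : ∀ {n} → SetFamily n → ℕ
codim Γ = ∣ vertexSet Γ ∣ ∸ rank Γ

isAntifacet : ∀ {n} → SetFamily n → Subset n → Bool
isAntifacet Γ S = ⌊ S ⊆? vertexSet Γ ⌋ ∧ (⌊ ∣ S ∣ ≟ rank Γ ⌋ ∧ not (Γ S))

antifacetCount : ∀ {n} → SetFamily n → ℕ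
antifacetCount {n} Γ = countB (isAntifacet Γ) (subsets n)

-- link_Δ(v) = { G : v ∉ G, G ∪ {v} ∈ Δ }, as a family of subsets of [n];
-- its own vertex set is vertexSet (link Δ v).
link : ∀ {n} → SetFamily n → Fin n → SetFamily n
link Γ v G = not (lookup G v) ∧ Γ (G ∪ ⁅ v ⁆)

-- Let L be the link of v, r its rank (dimension + 1), W its vertex set and k = n - 1 - |W|
-- the number of vertices not adjacent to v. A facet of L together with v is a facet of Δ, so
-- purity gives rank Δ = r + 1 and hence codim Δ = codim L + k. Now count the (r + 1)-sets
-- through v. Those inside W ∪ {v} that are not faces are, after removing v, exactly the
-- antifacets of L; those not inside W ∪ {v} are never faces, and there are
-- C(n - 1, r) - C(|W|, r) ≥ 2k of them once r ≥ 2. So ē(Δ) ≥ ē(L) + 2k, and the bound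
-- ē(Δ) ≤ 2(codim L + k) - 1 passes to L. If r ≤ 1, every r-subset of W is a face of L and ē(L) = 0.

module Submission where

open import Defs
open import Data.Bool using (Bool; true; false; T; not; _∧_; if_then_else_)
open import Data.Bool.Properties using (T-∧; T-not-≡; T-≡; ∧-zeroʳ; ∧-assoc)
open import Data.Empty using (⊥-elim)
open import Data.Fin using (Fin; zero; suc)
open import Data.Fin.Subset using (Subset; _⊆_; _∈_; _∉_; ∣_∣; ⁅_⁆; _∪_; _─_; _-_; ∁; inside; outside; ⊥; ⊤)
open import Data.Fin.Subset.Properties
  using ( _⊆?_; ⊆⊤; ⊆-antisym; ⊆-trans; p⊆q⇒∣p∣≤∣q∣; x∈⁅x⁆; x∈⁅y⁆⇒x≡y; ∉⊥; ∣⊤∣≡n; ∣⁅x⁆∣≡1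
        ; ∪-identityˡ; ∪-identityʳ; ∪-comm; x∈p∪q⁻; p⊆p∪q; q⊆p∪q; ∣∁p∣≡n∸∣p∣; x∉p⇒x∈∁p; x∈p⇒x∉∁p; p∪∁p≡⊤
        ; p─⊥≡p; drop-there; drop-not-there; drop-∷-⊆)
open import Data.List using (List; []; _∷_; map; _++_; foldr)
open import Data.List.Membership.Propositional using () renaming (_∈_ to _∈ˡ_)
open import Data.List.Membership.Propositional.Properties using (∈-map⁺; ∈-++⁺ˡ; ∈-++⁺ʳ)
open import Data.List.Relation.Unary.Any using () renaming (here to hereˡ; there to thereˡ)
open import Data.Nat using (ℕ; zero; suc; _+_; _*_; _∸_; _⊔_; _≤_; z≤n; s≤s; _≟_; _≤?_)
open import Data.Nat.Combinatorics using (_C_; nCk+nC[k+1]≡[n+1]C[k+1])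
open import Data.Nat.Properties
  using ( ≤-refl; ≤-reflexive; ≤-antisym; ≤-trans; ≤-total; ≤-pred; <-irrefl; n≤0⇒n≡0; suc-injective; m≤n⇒m≤1+n
        ; m≤m+n; m∸n≤m; ≰⇒>; +-cancelʳ-≤; +-mono-≤; +-monoˡ-≤; +-monoʳ-≤
        ; +-suc; +-comm; +-assoc; +-identityʳ; *-suc; *-distribˡ-+
        ; m+[n∸m]≡n; +-∸-comm; ∸-+-assoc; m≤m⊔n; m≤n⊔m; m≤n⇒m⊔n≡n; m≥n⇒m⊔n≡m; ⊔-identityʳ; module ≤-Reasoning)
open import Data.Product using (_×_; _,_; proj₁; proj₂; ∃-syntax)
open import Data.Sum using (_⊎_; inj₁; inj₂; [_,_])
open import Data.Vec using (lookup; here) renaming (_∷_ to _∷ᵛ_; [] to []ᵛ)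
open import Data.Vec.Properties using ([]=⇒lookup; lookup⇒[]=; lookup∘tabulate)
open import Function using (_∘_; case_of_)
open import Function.Bundles using (Equivalence)
open import Relation.Nullary using (¬_)
open import Relation.Nullary.Decidable using (Dec; does; yes; no; dec-true)
open import Relation.Binary.PropositionalEquality hiding ([_])

open Equivalence using (to; from)

-- Subsets of Fin n

module _ {n : ℕ} where

  lookup≡false⇒∉ : {p : Subset n} {x : Fin n} → lookup p x ≡ false → x ∉ p
  lookup≡false⇒∉ px≡false x∈p = case trans (sym ([]=⇒lookup x∈p)) px≡false of λ ()

  ∉⇒lookup≡false : {p : Subset n} {x : Fin n} → x ∉ p → lookup p x ≡ false
  ∉⇒lookup≡false {p} {x} x∉p with lookup p x in px
  ... | false = refl
  ... | true  = ⊥-elim (x∉p (lookup⇒[]= x p px))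

  ∪-lub : {p q r : Subset n} → p ⊆ r → q ⊆ r → p ∪ q ⊆ r
  ∪-lub {p} {q} p⊆r q⊆r x∈p∪q = [ p⊆r , q⊆r ] (x∈p∪q⁻ p q x∈p∪q)

  p⊆q⇒p∪r⊆q∪r : {p q : Subset n} (r : Subset n) → p ⊆ q → p ∪ r ⊆ q ∪ r
  p⊆q⇒p∪r⊆q∪r {q = q} r p⊆q = ∪-lub (⊆-trans p⊆q (p⊆p∪q r)) (q⊆p∪q q r)

  ⁅x⁆⊆p : {p : Subset n} {x : Fin n} → x ∈ p → ⁅ x ⁆ ⊆ p
  ⁅x⁆⊆p {x = x} x∈p y∈⁅x⁆ rewrite x∈⁅y⁆⇒x≡y x y∈⁅x⁆ = x∈p

∣p∪⁅x⁆∣≡1+∣p∣ : ∀ {n} (p : Subset n) (x : Fin n) → x ∉ p → ∣ p ∪ ⁅ x ⁆ ∣ ≡ suc ∣ p ∣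
∣p∪⁅x⁆∣≡1+∣p∣ (outside ∷ᵛ p) zero    _   = cong suc (cong ∣_∣ (∪-identityʳ p))
∣p∪⁅x⁆∣≡1+∣p∣ (inside  ∷ᵛ p) zero    x∉p = ⊥-elim (x∉p here)
∣p∪⁅x⁆∣≡1+∣p∣ (outside ∷ᵛ p) (suc x) x∉p = ∣p∪⁅x⁆∣≡1+∣p∣ p x (drop-not-there x∉p)
∣p∪⁅x⁆∣≡1+∣p∣ (inside  ∷ᵛ p) (suc x) x∉p = cong suc (∣p∪⁅x⁆∣≡1+∣p∣ p x (drop-not-there x∉p))

x∉p-x : ∀ {n} (p : Subset n) (x : Fin n) → x ∉ p - x
x∉p-x (b ∷ᵛ p) zero    ()
x∉p-x (b ∷ᵛ p) (suc x) x∈p-x = x∉p-x p x (drop-there x∈p-x)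

p-x∪⁅x⁆≡p : ∀ {n} (p : Subset n) (x : Fin n) → x ∈ p → (p - x) ∪ ⁅ x ⁆ ≡ p
p-x∪⁅x⁆≡p (inside  ∷ᵛ p) zero    _    = cong (inside ∷ᵛ_) (trans (∪-identityʳ (p ─ ⊥)) (p─⊥≡p p))
p-x∪⁅x⁆≡p (outside ∷ᵛ p) (suc x) x∈p = cong (outside ∷ᵛ_) (p-x∪⁅x⁆≡p p x (drop-there x∈p))
p-x∪⁅x⁆≡p (inside  ∷ᵛ p) (suc x) x∈p = cong (inside ∷ᵛ_) (p-x∪⁅x⁆≡p p x (drop-there x∈p))

∣p∣≡1+∣p-x∣ : ∀ {n} (p : Subset n) (x : Fin n) → x ∈ p → ∣ p ∣ ≡ suc ∣ p - x ∣
∣p∣≡1+∣p-x∣ p x x∈p = trans (cong ∣_∣ (sym (p-x∪⁅x⁆≡p p x x∈p))) (∣p∪⁅x⁆∣≡1+∣p∣ (p - x) x (x∉p-x p x))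

∣∁⁅x⁆∣≡n∸1 : ∀ {n} (x : Fin n) → ∣ ∁ ⁅ x ⁆ ∣ ≡ n ∸ 1
∣∁⁅x⁆∣≡n∸1 {n} x = trans (∣∁p∣≡n∸∣p∣ ⁅ x ⁆) (cong (n ∸_) (∣⁅x⁆∣≡1 x))

p⊆q∧∣q∣≤∣p∣⇒p≡q : ∀ {n} {p q : Subset n} → p ⊆ q → ∣ q ∣ ≤ ∣ p ∣ → p ≡ q
p⊆q∧∣q∣≤∣p∣⇒p≡q {p = []ᵛ}          {[]ᵛ}          _   _ = refl
p⊆q∧∣q∣≤∣p∣⇒p≡q {p = inside  ∷ᵛ p} {outside ∷ᵛ q} p⊆q _ = case p⊆q here of λ ()
p⊆q∧∣q∣≤∣p∣⇒p≡q {p = inside  ∷ᵛ p} {inside  ∷ᵛ q} p⊆q ∣q∣≤∣p∣ =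
  cong (inside ∷ᵛ_) (p⊆q∧∣q∣≤∣p∣⇒p≡q (drop-∷-⊆ p⊆q) (≤-pred ∣q∣≤∣p∣))
p⊆q∧∣q∣≤∣p∣⇒p≡q {p = outside ∷ᵛ p} {outside ∷ᵛ q} p⊆q ∣q∣≤∣p∣ =
  cong (outside ∷ᵛ_) (p⊆q∧∣q∣≤∣p∣⇒p≡q (drop-∷-⊆ p⊆q) ∣q∣≤∣p∣)
p⊆q∧∣q∣≤∣p∣⇒p≡q {p = outside ∷ᵛ p} {inside  ∷ᵛ q} p⊆q ∣q∣≤∣p∣ =
  ⊥-elim (<-irrefl refl (≤-trans (s≤s (p⊆q⇒∣p∣≤∣q∣ (drop-∷-⊆ p⊆q))) ∣q∣≤∣p∣))

∣p∣≡0⇒p≡⊥ : ∀ {n} (p : Subset n) → ∣ p ∣ ≡ 0 → p ≡ ⊥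
∣p∣≡0⇒p≡⊥ []ᵛ            _ = refl
∣p∣≡0⇒p≡⊥ (outside ∷ᵛ p) e = cong (outside ∷ᵛ_) (∣p∣≡0⇒p≡⊥ p e)

∣p∣≡1⇒p≡⁅x⁆ : ∀ {n} (p : Subset n) → ∣ p ∣ ≡ 1 → ∃[ x ] p ≡ ⁅ x ⁆
∣p∣≡1⇒p≡⁅x⁆ (outside ∷ᵛ p) e with ∣p∣≡1⇒p≡⁅x⁆ p e
... | x , p≡⁅x⁆ = suc x , cong (outside ∷ᵛ_) p≡⁅x⁆
∣p∣≡1⇒p≡⁅x⁆ (inside ∷ᵛ p) e = zero , cong (inside ∷ᵛ_) (∣p∣≡0⇒p≡⊥ p (suc-injective e))

-- Counting

module _ {A : Set} where

  countB-mono : {p q : A → Bool} (xs : List A) → (∀ x → T (p x) → T (q x)) → countB p xs ≤ countB q xs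
  countB-mono [] p⇒q = z≤n
  countB-mono {p} {q} (x ∷ xs) p⇒q with p x in px | q x in qx
  ... | true  | true  = s≤s (countB-mono xs p⇒q)
  ... | true  | false = ⊥-elim (subst T qx (p⇒q x (subst T (sym px) _)))
  ... | false | true  = m≤n⇒m≤1+n (countB-mono xs p⇒q)
  ... | false | false = countB-mono xs p⇒q

  countB-cong : {p q : A → Bool} (xs : List A) → (∀ x → T (p x) → T (q x)) → (∀ x → T (q x) → T (p x)) →
    countB p xs ≡ countB q xs
  countB-cong xs p⇒q q⇒p = ≤-antisym (countB-mono xs p⇒q) (countB-mono xs q⇒p)

  countB-≗ : {p q : A → Bool} (xs : List A) → p ≗ q → countB p xs ≡ countB q xs
  countB-≗ xs p≗q = countB-cong xs (λ x → subst T (p≗q x)) (λ x → subst T (sym (p≗q x)))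

  countB-false : (xs : List A) → countB (λ _ → false) xs ≡ 0
  countB-false []       = refl
  countB-false (x ∷ xs) = countB-false xs

  countB-++ : (p : A → Bool) (xs ys : List A) → countB p (xs ++ ys) ≡ countB p xs + countB p ys
  countB-++ p []       ys = refl
  countB-++ p (x ∷ xs) ys with p x
  ... | true  = cong suc (countB-++ p xs ys)
  ... | false = countB-++ p xs ys

  countB-∧-not-+ : {p s : A → Bool} (xs : List A) → (∀ x → T (s x) → T (p x)) →
    countB (λ x → p x ∧ not (s x)) xs + countB s xs ≡ countB p xs
  countB-∧-not-+ [] s⇒p = refl
  countB-∧-not-+ {p} {s} (x ∷ xs) s⇒p with p x in px | s x in sx
  ... | true  | true  = trans (+-suc _ _) (cong suc (countB-∧-not-+ xs s⇒p))
  ... | true  | false = cong suc (countB-∧-not-+ xs s⇒p)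
  ... | false | false = countB-∧-not-+ xs s⇒p
  ... | false | true  = ⊥-elim (subst T px (s⇒p x (subst T (sym sx) _)))

  countB-disjoint-+ : {p q r : A → Bool} (xs : List A) → (∀ x → T (p x) → ¬ T (q x)) →
    (∀ x → T (p x) → T (r x)) → (∀ x → T (q x) → T (r x)) → countB p xs + countB q xs ≤ countB r xs
  countB-disjoint-+ [] disj p⇒r q⇒r = z≤n
  countB-disjoint-+ {p} {q} {r} (x ∷ xs) disj p⇒r q⇒r with p x in px | q x in qx | r x in rx
  ... | true  | true  | _     = ⊥-elim (disj x (subst T (sym px) _) (subst T (sym qx) _))
  ... | true  | false | true  = s≤s (countB-disjoint-+ xs disj p⇒r q⇒r)
  ... | false | true  | true  = subst (_≤ suc (countB r xs)) (sym (+-suc (countB p xs) (countB q xs)))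
                                  (s≤s (countB-disjoint-+ xs disj p⇒r q⇒r))
  ... | false | false | true  = m≤n⇒m≤1+n (countB-disjoint-+ xs disj p⇒r q⇒r)
  ... | false | false | false = countB-disjoint-+ xs disj p⇒r q⇒r
  ... | true  | false | false = ⊥-elim (subst T rx (p⇒r x (subst T (sym px) _)))
  ... | false | true  | false = ⊥-elim (subst T rx (q⇒r x (subst T (sym qx) _)))

countB-map : {A B : Set} (p : B → Bool) (g : A → B) (xs : List A) → countB p (map g xs) ≡ countB (λ x → p (g x)) xs
countB-map p g []       = refl
countB-map p g (x ∷ xs) with p (g x)
... | true  = cong suc (countB-map p g xs)
... | false = countB-map p g xs

countB-subsets-suc : ∀ {n} (p : Subset (suc n) → Bool) →
  countB p (subsets (suc n)) ≡ countB (λ S → p (outside ∷ᵛ S)) (subsets n) + countB (λ S → p (inside ∷ᵛ S)) (subsets n)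
countB-subsets-suc {n} p = trans (countB-++ p (map (outside ∷ᵛ_) (subsets n)) _)
  (cong₂ _+_ (countB-map p _ (subsets n)) (countB-map p _ (subsets n)))

countB-subsets-∋ : ∀ {n} (v : Fin n) (f : Subset n → Bool) →
  countB (λ S → lookup S v ∧ f S) (subsets n) ≡ countB (λ S → not (lookup S v) ∧ f (S ∪ ⁅ v ⁆)) (subsets n)
countB-subsets-∋ {suc n} zero f = begin
  countB (λ S → lookup S zero ∧ f S) (subsets (suc n))
    ≡⟨ countB-subsets-suc (λ S → lookup S zero ∧ f S) ⟩
  countB (λ _ → false) ss + countB (λ S → f (inside ∷ᵛ S)) ss
    ≡⟨ cong₂ _+_ (countB-false ss) (countB-≗ ss (λ S → cong (λ S′ → f (inside ∷ᵛ S′)) (sym (∪-identityʳ S)))) ⟩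
  0 + countB (λ S → f (inside ∷ᵛ (S ∪ ⊥))) ss
    ≡⟨ +-comm 0 _ ⟩
  countB (λ S → f (inside ∷ᵛ (S ∪ ⊥))) ss + 0
    ≡⟨ cong (countB (λ S → f (inside ∷ᵛ (S ∪ ⊥))) ss +_) (sym (countB-false ss)) ⟩
  countB (λ S → f (inside ∷ᵛ (S ∪ ⊥))) ss + countB (λ _ → false) ss
    ≡⟨ countB-subsets-suc (λ S → not (lookup S zero) ∧ f (S ∪ ⁅ zero ⁆)) ⟨
  countB (λ S → not (lookup S zero) ∧ f (S ∪ ⁅ zero ⁆)) (subsets (suc n))
    ∎
  where open ≡-Reasoning
        ss = subsets n
countB-subsets-∋ {suc n} (suc w) f = trans (countB-subsets-suc (λ S → lookup S (suc w) ∧ f S))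
  (trans (cong₂ _+_ (countB-subsets-∋ w (λ S → f (outside ∷ᵛ S))) (countB-subsets-∋ w (λ S → f (inside ∷ᵛ S))))
         (sym (countB-subsets-suc (λ S → not (lookup S (suc w)) ∧ f (S ∪ ⁅ suc w ⁆)))))

-- does rather than ⌊_⌋: it reduces through the Dec.map inside _≟_ and _⊆?_, which countB-isSizedSubset needs.
isSizedSubset : ∀ {n} → ℕ → Subset n → Subset n → Bool
isSizedSubset j X S = does (∣ S ∣ ≟ j) ∧ does (S ⊆? X)

isSizedSubset⁺ : ∀ {n j} {X S : Subset n} → ∣ S ∣ ≡ j → S ⊆ X → T (isSizedSubset j X S)
isSizedSubset⁺ {j = j} {X} {S} ∣S∣≡j S⊆X =
  T-∧ .from (T-≡ .from (dec-true (∣ S ∣ ≟ j) ∣S∣≡j) , T-≡ .from (dec-true (S ⊆? X) S⊆X))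

isSizedSubset⁻ : ∀ {n j} {X S : Subset n} → T (isSizedSubset j X S) → ∣ S ∣ ≡ j × S ⊆ X
isSizedSubset⁻ {j = j} {X} {S} t with T-∧ .to t
... | ∣S∣≡?j , S⊆?X = witness (∣ S ∣ ≟ j) ∣S∣≡?j , witness (S ⊆? X) S⊆?X
  where
  witness : ∀ {A : Set} (a? : Dec A) → T (does a?) → A
  witness (yes a) _ = a

countB-isSizedSubset : ∀ {n} (X : Subset n) (j : ℕ) →
  countB (isSizedSubset j X) (subsets n) ≡ ∣ X ∣ C j
countB-isSizedSubset {zero} []ᵛ zero = refl
countB-isSizedSubset {zero} []ᵛ (suc j) = refl
countB-isSizedSubset {suc n} (x ∷ᵛ X) j = trans (countB-subsets-suc (isSizedSubset j (x ∷ᵛ X))) (split x j)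
  where
  ss = subsets n
  split : ∀ x j → countB (isSizedSubset j X) ss + countB (λ S → isSizedSubset j (x ∷ᵛ X) (inside ∷ᵛ S)) ss
                ≡ ∣ x ∷ᵛ X ∣ C j
  split outside j = trans (cong₂ _+_ (countB-isSizedSubset X j) (trans (countB-≗ ss (λ S → ∧-zeroʳ _)) (countB-false ss)))
                          (+-identityʳ (∣ X ∣ C j))
  split inside zero = trans (cong₂ _+_ (countB-isSizedSubset X zero) (countB-false ss)) refl
  split inside (suc j) = trans (cong₂ _+_ (countB-isSizedSubset X (suc j)) (countB-isSizedSubset X j))
    (trans (+-comm (∣ X ∣ C suc j) (∣ X ∣ C j)) (nCk+nC[k+1]≡[n+1]C[k+1] ∣ X ∣ j))

countB-∋-isSizedSubset : ∀ {n} (v : Fin n) (X : Subset n) (j : ℕ) → v ∉ X →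
  countB (λ S → lookup S v ∧ isSizedSubset (suc j) (X ∪ ⁅ v ⁆) S) (subsets n) ≡ ∣ X ∣ C j
countB-∋-isSizedSubset {n} v X j v∉X =
  trans (countB-subsets-∋ v (isSizedSubset (suc j) (X ∪ ⁅ v ⁆)))
    (trans (countB-cong (subsets n) shrink grow) (countB-isSizedSubset X j))
  where
  shrink : ∀ S → T (not (lookup S v) ∧ isSizedSubset (suc j) (X ∪ ⁅ v ⁆) (S ∪ ⁅ v ⁆)) → T (isSizedSubset j X S)
  shrink S t with T-∧ .to t
  ... | v∉?S , t′ with isSizedSubset⁻ t′
  ... | ∣S∪v∣≡1+j , S∪v⊆X∪v =
    isSizedSubset⁺ (suc-injective (trans (sym (∣p∪⁅x⁆∣≡1+∣p∣ S v v∉S)) ∣S∪v∣≡1+j)) S⊆X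
    where
    v∉S : v ∉ S
    v∉S = lookup≡false⇒∉ (T-not-≡ .to v∉?S)
    S⊆X : S ⊆ X
    S⊆X {u} u∈S with x∈p∪q⁻ X ⁅ v ⁆ (S∪v⊆X∪v (p⊆p∪q ⁅ v ⁆ u∈S))
    ... | inj₁ u∈X = u∈X
    ... | inj₂ u∈⁅v⁆ rewrite x∈⁅y⁆⇒x≡y v u∈⁅v⁆ = ⊥-elim (v∉S u∈S)
  grow : ∀ S → T (isSizedSubset j X S) → T (not (lookup S v) ∧ isSizedSubset (suc j) (X ∪ ⁅ v ⁆) (S ∪ ⁅ v ⁆))
  grow S t with isSizedSubset⁻ t
  ... | ∣S∣≡j , S⊆X = T-∧ .from (T-not-≡ .from (∉⇒lookup≡false v∉S) ,
          isSizedSubset⁺ (trans (∣p∪⁅x⁆∣≡1+∣p∣ S v v∉S) (cong suc ∣S∣≡j))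
                         (p⊆q⇒p∪r⊆q∪r ⁅ v ⁆ S⊆X))
    where
    v∉S : v ∉ S
    v∉S = v∉X ∘ S⊆X

-- Binomial coefficients

1≤nCk : ∀ {n k} → k ≤ n → 1 ≤ n C k
1≤nCk {n}     {zero}  _         = ≤-refl
1≤nCk {suc n} {suc k} (s≤s k≤n) =
  ≤-trans (1≤nCk k≤n) (subst (n C k ≤_) (nCk+nC[k+1]≡[n+1]C[k+1] n k) (m≤m+n (n C k) (n C suc k)))

nCk+2≤[n+1]Ck : ∀ {n k} → 2 ≤ k → k ≤ n → n C k + 2 ≤ suc n C k
nCk+2≤[n+1]Ck {suc (suc n)} {suc (suc k)} (s≤s (s≤s _)) (s≤s (s≤s k≤n)) = begin
  N C suc (suc k) + 2                  ≤⟨ +-monoʳ-≤ (N C suc (suc k)) two≤NC[k+1] ⟩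
  N C suc (suc k) + N C suc k          ≡⟨ +-comm (N C suc (suc k)) (N C suc k) ⟩
  N C suc k + N C suc (suc k)          ≡⟨ nCk+nC[k+1]≡[n+1]C[k+1] N (suc k) ⟩
  suc N C suc (suc k)                  ∎
  where
  open ≤-Reasoning
  N = suc (suc n)
  two≤NC[k+1] : 2 ≤ N C suc k
  two≤NC[k+1] = ≤-trans (+-mono-≤ (1≤nCk (m≤n⇒m≤1+n k≤n)) (1≤nCk (s≤s k≤n)))
                        (≤-reflexive (nCk+nC[k+1]≡[n+1]C[k+1] (suc n) k))

nCk+2m≤[n+m]Ck : ∀ {n k} m → 2 ≤ k → k ≤ n → n C k + 2 * m ≤ (n + m) C k
nCk+2m≤[n+m]Ck {n} {k} zero    _   _   = ≤-reflexive (trans (+-identityʳ (n C k)) (cong (_C k) (sym (+-identityʳ n))))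
nCk+2m≤[n+m]Ck {n} {k} (suc m) 2≤k k≤n = begin
  n C k + 2 * suc m     ≡⟨ cong (n C k +_) (trans (*-suc 2 m) (+-comm 2 (2 * m))) ⟩
  n C k + (2 * m + 2)   ≡⟨ +-assoc (n C k) (2 * m) 2 ⟨
  n C k + 2 * m + 2     ≤⟨ +-monoˡ-≤ 2 (nCk+2m≤[n+m]Ck m 2≤k k≤n) ⟩
  (n + m) C k + 2       ≤⟨ nCk+2≤[n+1]Ck 2≤k (≤-trans k≤n (m≤m+n n m)) ⟩
  suc (n + m) C k       ≡⟨ cong (_C k) (+-suc n m) ⟨
  (n + suc m) C k       ∎
  where open ≤-Reasoning

+-cancelʳ-≤-∸1 : ∀ x y z → x + y ≤ (z + y) ∸ 1 → x ≤ z ∸ 1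
+-cancelʳ-≤-∸1 x y zero    x+y≤y∸1 = +-cancelʳ-≤ y x 0 (≤-trans x+y≤y∸1 (m∸n≤m y 1))
+-cancelʳ-≤-∸1 x y (suc z) x+y≤z+y = +-cancelʳ-≤ y x z x+y≤z+y

-- Rank, facets and antifacets

∈-subsets : ∀ {n} (S : Subset n) → S ∈ˡ subsets n
∈-subsets {zero}  []ᵛ            = hereˡ refl
∈-subsets {suc n} (outside ∷ᵛ S) = ∈-++⁺ˡ (∈-map⁺ (outside ∷ᵛ_) (∈-subsets S))
∈-subsets {suc n} (inside  ∷ᵛ S) = ∈-++⁺ʳ (map (outside ∷ᵛ_) (subsets n)) (∈-map⁺ (inside ∷ᵛ_) (∈-subsets S))

module _ {n : ℕ} (Γ : SetFamily n) where

  private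
    rankIn : List (Subset n) → ℕ
    rankIn = foldr (λ F m → if Γ F then ∣ F ∣ ⊔ m else m) 0

    rankIn-upper : ∀ {F xs} → F ∈ˡ xs → T (Γ F) → ∣ F ∣ ≤ rankIn xs
    rankIn-upper {F} (hereˡ refl) ΓF with Γ F
    ... | true = m≤m⊔n _ _
    rankIn-upper {xs = G ∷ _} (thereˡ F∈xs) ΓF with Γ G
    ... | true  = ≤-trans (rankIn-upper F∈xs ΓF) (m≤n⊔m _ _)
    ... | false = rankIn-upper F∈xs ΓF

    rankIn-attained : ∀ xs → rankIn xs ≡ 0 ⊎ ∃[ F ] T (Γ F) × ∣ F ∣ ≡ rankIn xs
    rankIn-attained [] = inj₁ refl
    rankIn-attained (G ∷ xs) with Γ G in ΓG | rankIn-attained xs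
    ... | false | ih = ih
    ... | true  | inj₁ r≡0 = inj₂ (G , T-≡ .from ΓG , sym (trans (cong (∣ G ∣ ⊔_) r≡0) (⊔-identityʳ ∣ G ∣)))
    ... | true  | inj₂ (F , ΓF , ∣F∣≡r) with ≤-total ∣ G ∣ (rankIn xs)
    ...   | inj₁ ∣G∣≤r = inj₂ (F , ΓF , trans ∣F∣≡r (sym (m≤n⇒m⊔n≡n ∣G∣≤r)))
    ...   | inj₂ r≤∣G∣ = inj₂ (G , T-≡ .from ΓG , sym (m≥n⇒m⊔n≡m r≤∣G∣))

  rank-upper : ∀ {F} → T (Γ F) → ∣ F ∣ ≤ rank Γ
  rank-upper {F} = rankIn-upper (∈-subsets F)

  rank-attained : ∀ {F₀} → T (Γ F₀) → ∃[ F ] T (Γ F) × ∣ F ∣ ≡ rank Γ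
  rank-attained {F₀} ΓF₀ with rankIn-attained (subsets n)
  ... | inj₂ attained = attained
  ... | inj₁ rank≡0   = F₀ , ΓF₀ , trans (n≤0⇒n≡0 (subst (∣ F₀ ∣ ≤_) rank≡0 (rank-upper ΓF₀))) (sym rank≡0)

  facet-if-no-larger-superface : ∀ {F} → T (Γ F) → (∀ H → T (Γ H) → F ⊆ H → ∣ H ∣ ≤ ∣ F ∣) → Facet Γ F
  facet-if-no-larger-superface ΓF no-larger = ΓF , λ H ΓH F⊆H → p⊆q∧∣q∣≤∣p∣⇒p≡q F⊆H (no-larger H ΓH F⊆H)

  facet-of-size-rank : ∀ {F₀} → T (Γ F₀) → ∃[ F ] Facet Γ F × ∣ F ∣ ≡ rank Γ
  facet-of-size-rank ΓF₀ with rank-attained ΓF₀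
  ... | F , ΓF , ∣F∣≡rank =
    F , facet-if-no-larger-superface ΓF (λ H ΓH _ → subst (∣ H ∣ ≤_) (sym ∣F∣≡rank) (rank-upper ΓH)) , ∣F∣≡rank

∈-vertexSet : ∀ {n} (Γ : SetFamily n) {u : Fin n} → T (Γ ⁅ u ⁆) → u ∈ vertexSet Γ
∈-vertexSet Γ {u} Γ⁅u⁆ = lookup⇒[]= u (vertexSet Γ) (trans (lookup∘tabulate (λ w → Γ ⁅ w ⁆) u) (T-≡ .to Γ⁅u⁆))

∈-vertexSet⁻ : ∀ {n} (Γ : SetFamily n) {u : Fin n} → u ∈ vertexSet Γ → T (Γ ⁅ u ⁆)
∈-vertexSet⁻ Γ {u} u∈V = T-≡ .from (trans (sym (lookup∘tabulate (λ w → Γ ⁅ w ⁆) u)) ([]=⇒lookup u∈V))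

vertexSet≡⊤ : ∀ {n} (Δ : SimplicialComplex n) → vertexSet (face Δ) ≡ ⊤
vertexSet≡⊤ Δ = ⊆-antisym ⊆⊤ (λ {u} _ → ∈-vertexSet (face Δ) (singletons Δ u))

isAntifacet⁺ : ∀ {n} (Γ : SetFamily n) {S : Subset n} →
  S ⊆ vertexSet Γ → ∣ S ∣ ≡ rank Γ → Γ S ≡ false → T (isAntifacet Γ S)
isAntifacet⁺ Γ {S} S⊆V ∣S∣≡rank ΓS≡false with S ⊆? vertexSet Γ | ∣ S ∣ ≟ rank Γ
... | yes _    | yes _       = T-not-≡ .from ΓS≡false
... | no S⊈V   | _           = S⊈V S⊆V
... | yes _    | no ∣S∣≢rank = ∣S∣≢rank ∣S∣≡rank

isAntifacet⁻ : ∀ {n} (Γ : SetFamily n) {S : Subset n} →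
  T (isAntifacet Γ S) → S ⊆ vertexSet Γ × ∣ S ∣ ≡ rank Γ × Γ S ≡ false
isAntifacet⁻ Γ {S} t with S ⊆? vertexSet Γ | ∣ S ∣ ≟ rank Γ
... | yes S⊆V | yes ∣S∣≡rank = S⊆V , ∣S∣≡rank , T-not-≡ .to t

-- Links

module _ {n : ℕ} (Δ : SimplicialComplex n) (v : Fin n) where

  private
    Γ = face Δ
    L = link Γ v
    W = vertexSet L

  link≡face-∪ : ∀ {S} → v ∉ S → L S ≡ Γ (S ∪ ⁅ v ⁆)
  link≡face-∪ v∉S = cong (λ b → not b ∧ Γ (_ ∪ ⁅ v ⁆)) (∉⇒lookup≡false v∉S)

  ∉-link : ∀ {S} → T (L S) → v ∉ S
  ∉-link LS = lookup≡false⇒∉ (T-not-≡ .to (T-∧ .to LS .proj₁))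

  v∉link-vertexSet : v ∉ W
  v∉link-vertexSet v∈W = ∉-link (∈-vertexSet⁻ L v∈W) (x∈⁅x⁆ v)

  link-face-⊆ : ∀ {S} → T (L S) → S ⊆ W
  link-face-⊆ {S} LS {u} u∈S = ∈-vertexSet L (subst T (sym (link≡face-∪ v∉⁅u⁆)) Γ⁅u⁆∪⁅v⁆)
    where
    v∉⁅u⁆ : v ∉ ⁅ u ⁆
    v∉⁅u⁆ v∈⁅u⁆ = ∉-link LS (subst (_∈ S) (sym (x∈⁅y⁆⇒x≡y u v∈⁅u⁆)) u∈S)
    Γ⁅u⁆∪⁅v⁆ : T (Γ (⁅ u ⁆ ∪ ⁅ v ⁆))
    Γ⁅u⁆∪⁅v⁆ = downClosed Δ (S ∪ ⁅ v ⁆) _ (∪-lub (⁅x⁆⊆p (p⊆p∪q ⁅ v ⁆ u∈S)) (q⊆p∪q S ⁅ v ⁆)) (T-∧ .to LS .proj₂)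

  link-face-remove : ∀ {H} → v ∈ H → T (Γ H) → T (L (H - v))
  link-face-remove {H} v∈H ΓH = subst T (sym (trans (link≡face-∪ (x∉p-x H v)) (cong Γ (p-x∪⁅x⁆≡p H v v∈H)))) ΓH

  face-∋-⊆ : ∀ {S} → v ∈ S → T (Γ S) → S ⊆ W ∪ ⁅ v ⁆
  face-∋-⊆ v∈S ΓS = subst (_⊆ W ∪ ⁅ v ⁆) (p-x∪⁅x⁆≡p _ v v∈S)
    (p⊆q⇒p∪r⊆q∪r ⁅ v ⁆ (link-face-⊆ (link-face-remove v∈S ΓS)))

  ∅∈link : T (L ⊥)
  ∅∈link = subst T (sym (trans (link≡face-∪ ∉⊥) (cong Γ (∪-identityˡ ⁅ v ⁆)))) (singletons Δ v)

  link-face-small : ∀ {S} → S ⊆ W → ∣ S ∣ ≤ 1 → T (L S)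
  link-face-small {S} S⊆W ∣S∣≤1 with ∣ S ∣ in ∣S∣≡
  ... | zero = subst (T ∘ L) (sym (∣p∣≡0⇒p≡⊥ S ∣S∣≡)) ∅∈link
  ... | suc zero with ∣p∣≡1⇒p≡⁅x⁆ S ∣S∣≡
  ...   | u , refl = ∈-vertexSet⁻ L (S⊆W (x∈⁅x⁆ u))
  link-face-small S⊆W (s≤s ()) | suc (suc _)

  antifacetCount-link≡0 : rank L ≤ 1 → antifacetCount L ≡ 0
  antifacetCount-link≡0 r≤1 = n≤0⇒n≡0 (subst (antifacetCount L ≤_) (countB-false (subsets n)) (countB-mono (subsets n) no-antifacet))
    where
    no-antifacet : ∀ S → T (isAntifacet L S) → T false
    no-antifacet S t with isAntifacet⁻ L {S} t
    ... | S⊆W , ∣S∣≡r , LS≡false = subst T LS≡false (link-face-small S⊆W (subst (_≤ 1) (sym ∣S∣≡r) r≤1))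

  rank-link≤∣vertexSet∣ : rank L ≤ ∣ W ∣
  rank-link≤∣vertexSet∣ with rank-attained L ∅∈link
  ... | G , LG , ∣G∣≡r = subst (_≤ ∣ W ∣) ∣G∣≡r (p⊆q⇒∣p∣≤∣q∣ (link-face-⊆ LG))

  ∣link-vertexSet∣≤n∸1 : ∣ W ∣ ≤ n ∸ 1
  ∣link-vertexSet∣≤n∸1 = subst (∣ W ∣ ≤_) (∣∁⁅x⁆∣≡n∸1 v)
    (p⊆q⇒∣p∣≤∣q∣ λ {u} u∈W → x∉p⇒x∈∁p λ u∈⁅v⁆ → v∉link-vertexSet (subst (_∈ W) (x∈⁅y⁆⇒x≡y v u∈⁅v⁆) u∈W))

  rank≡1+rank-link : Pure Γ → rank Γ ≡ suc (rank L)
  rank≡1+rank-link pure with rank-attained L ∅∈link | facet-of-size-rank Γ (singletons Δ v)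
  ... | G , LG , ∣G∣≡r | F , facetF , ∣F∣≡rank =
    trans (sym ∣F∣≡rank) (trans (pure F (G ∪ ⁅ v ⁆) facetF facetG∪v) ∣G∪v∣≡1+r)
    where
    v∉G : v ∉ G
    v∉G = ∉-link LG
    ∣G∪v∣≡1+r : ∣ G ∪ ⁅ v ⁆ ∣ ≡ suc (rank L)
    ∣G∪v∣≡1+r = trans (∣p∪⁅x⁆∣≡1+∣p∣ G v v∉G) (cong suc ∣G∣≡r)
    no-larger : ∀ H → T (Γ H) → G ∪ ⁅ v ⁆ ⊆ H → ∣ H ∣ ≤ ∣ G ∪ ⁅ v ⁆ ∣
    no-larger H ΓH G∪v⊆H = begin
      ∣ H ∣           ≡⟨ ∣p∣≡1+∣p-x∣ H v v∈H ⟩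
      suc ∣ H - v ∣   ≤⟨ s≤s (rank-upper L (link-face-remove v∈H ΓH)) ⟩
      suc (rank L)    ≡⟨ ∣G∪v∣≡1+r ⟨
      ∣ G ∪ ⁅ v ⁆ ∣   ∎
      where
      open ≤-Reasoning
      v∈H : v ∈ H
      v∈H = G∪v⊆H (q⊆p∪q G ⁅ v ⁆ (x∈⁅x⁆ v))
    facetG∪v : Facet Γ (G ∪ ⁅ v ⁆)
    facetG∪v = facet-if-no-larger-superface Γ (subst T (link≡face-∪ v∉G) LG) no-larger

  codim≡codim-link+ : Pure Γ → codim Γ ≡ codim L + (n ∸ 1 ∸ ∣ W ∣)
  codim≡codim-link+ pure = begin
    ∣ vertexSet Γ ∣ ∸ rank Γ             ≡⟨ cong₂ _∸_ (trans (cong ∣_∣ (vertexSet≡⊤ Δ)) (∣⊤∣≡n n)) (rank≡1+rank-link pure) ⟩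
    n ∸ suc (rank L)                     ≡⟨ ∸-+-assoc n 1 (rank L) ⟨
    n ∸ 1 ∸ rank L                       ≡⟨ cong (_∸ rank L) (m+[n∸m]≡n ∣link-vertexSet∣≤n∸1) ⟨
    ∣ W ∣ + (n ∸ 1 ∸ ∣ W ∣) ∸ rank L     ≡⟨ +-∸-comm (n ∸ 1 ∸ ∣ W ∣) rank-link≤∣vertexSet∣ ⟩
    ∣ W ∣ ∸ rank L + (n ∸ 1 ∸ ∣ W ∣)     ∎
    where open ≡-Reasoning

  -- W ∪ ⁅ v ⁆ is the vertex set of the closed star of v.
  through-v : Subset n → Subset n → Bool
  through-v X S = lookup S v ∧ isSizedSubset (suc (rank L)) (X ∪ ⁅ v ⁆) S

  nonFaceInStar leavesStar : Subset n → Bool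
  nonFaceInStar S = through-v W S ∧ not (Γ S)
  leavesStar    S = through-v (∁ ⁅ v ⁆) S ∧ not (through-v W S)

  antifacetCount-link≤ : antifacetCount L ≤ countB nonFaceInStar (subsets n)
  antifacetCount-link≤ = begin
    antifacetCount L                                              ≤⟨ countB-mono (subsets n) add-v ⟩
    countB (λ S → not (lookup S v) ∧ f (S ∪ ⁅ v ⁆)) (subsets n)  ≡⟨ countB-subsets-∋ v f ⟨
    countB (λ S → lookup S v ∧ f S) (subsets n)                  ≡⟨ countB-≗ (subsets n) (λ S → ∧-assoc (lookup S v) _ _) ⟨
    countB nonFaceInStar (subsets n)                             ∎
    where
    open ≤-Reasoning
    f : Subset n → Bool
    f S = isSizedSubset (suc (rank L)) (W ∪ ⁅ v ⁆) S ∧ not (Γ S)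
    add-v : ∀ S → T (isAntifacet L S) → T (not (lookup S v) ∧ f (S ∪ ⁅ v ⁆))
    add-v S t with isAntifacet⁻ L {S} t
    ... | S⊆W , ∣S∣≡r , LS≡false = T-∧ .from (T-not-≡ .from (∉⇒lookup≡false v∉S) ,
          T-∧ .from (isSizedSubset⁺ (trans (∣p∪⁅x⁆∣≡1+∣p∣ S v v∉S) (cong suc ∣S∣≡r)) (p⊆q⇒p∪r⊆q∪r ⁅ v ⁆ S⊆W) ,
                     T-not-≡ .from (trans (sym (link≡face-∪ v∉S)) LS≡false)))
      where
      v∉S : v ∉ S
      v∉S = v∉link-vertexSet ∘ S⊆W

  countB-leavesStar+ : countB leavesStar (subsets n) + ∣ W ∣ C rank L ≡ (n ∸ 1) C rank L
  countB-leavesStar+ = begin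
    countB leavesStar ss + ∣ W ∣ C rank L                  ≡⟨ cong (countB leavesStar ss +_) (countB-∋-isSizedSubset v W (rank L) v∉link-vertexSet) ⟨
    countB leavesStar ss + countB (through-v W) ss         ≡⟨ countB-∧-not-+ ss in-star⇒anywhere ⟩
    countB (through-v (∁ ⁅ v ⁆)) ss                        ≡⟨ countB-∋-isSizedSubset v (∁ ⁅ v ⁆) (rank L) (x∈p⇒x∉∁p (x∈⁅x⁆ v)) ⟩
    ∣ ∁ ⁅ v ⁆ ∣ C rank L                                   ≡⟨ cong (_C rank L) (∣∁⁅x⁆∣≡n∸1 v) ⟩
    (n ∸ 1) C rank L                                       ∎
    where
    open ≡-Reasoning
    ss = subsets n
    in-star⇒anywhere : ∀ S → T (through-v W S) → T (through-v (∁ ⁅ v ⁆) S)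
    in-star⇒anywhere S t with T-∧ {lookup S v} .to t
    ... | v∈?S , sized = T-∧ .from (v∈?S , isSizedSubset⁺ (isSizedSubset⁻ {X = W ∪ ⁅ v ⁆} {S} sized .proj₁) S⊆∁⁅v⁆∪⁅v⁆)
      where
      S⊆∁⁅v⁆∪⁅v⁆ : S ⊆ ∁ ⁅ v ⁆ ∪ ⁅ v ⁆
      S⊆∁⁅v⁆∪⁅v⁆ = subst (S ⊆_) (sym (trans (∪-comm (∁ ⁅ v ⁆) ⁅ v ⁆) (p∪∁p≡⊤ ⁅ v ⁆))) ⊆⊤

  countB-nonFaceInStar+leavesStar≤ : Pure Γ → countB nonFaceInStar (subsets n) + countB leavesStar (subsets n) ≤ antifacetCount Γ
  countB-nonFaceInStar+leavesStar≤ pure = countB-disjoint-+ (subsets n) disjoint nonFaceInStar⇒antifacet leavesStar⇒antifacet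
    where
    ⊆V : ∀ {S} → S ⊆ vertexSet Γ
    ⊆V {x = u} _ = ∈-vertexSet Γ (singletons Δ u)

    disjoint : ∀ S → T (nonFaceInStar S) → ¬ T (leavesStar S)
    disjoint S a b = subst T (T-not-≡ .to (T-∧ {through-v (∁ ⁅ v ⁆) S} .to b .proj₂)) (T-∧ {through-v W S} .to a .proj₁)

    nonFaceInStar⇒antifacet : ∀ S → T (nonFaceInStar S) → T (isAntifacet Γ S)
    nonFaceInStar⇒antifacet S a with T-∧ {through-v W S} .to a
    ... | in-star , ¬ΓS = isAntifacet⁺ Γ ⊆V (trans ∣S∣≡1+r (sym (rank≡1+rank-link pure))) (T-not-≡ .to ¬ΓS)
      where
      ∣S∣≡1+r : ∣ S ∣ ≡ suc (rank L)
      ∣S∣≡1+r = isSizedSubset⁻ {X = W ∪ ⁅ v ⁆} {S} (T-∧ {lookup S v} .to in-star .proj₂) .proj₁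

    leavesStar⇒antifacet : ∀ S → T (leavesStar S) → T (isAntifacet Γ S)
    leavesStar⇒antifacet S b with T-∧ {through-v (∁ ⁅ v ⁆) S} .to b
    ... | anywhere , ¬in-star with T-∧ {lookup S v} .to anywhere
    ... | v∈?S , sized = isAntifacet⁺ Γ ⊆V (trans ∣S∣≡1+r (sym (rank≡1+rank-link pure))) ΓS≡false
      where
      ∣S∣≡1+r : ∣ S ∣ ≡ suc (rank L)
      ∣S∣≡1+r = isSizedSubset⁻ {X = ∁ ⁅ v ⁆ ∪ ⁅ v ⁆} {S} sized .proj₁
      ΓS≡false : Γ S ≡ false
      ΓS≡false with Γ S in ΓS
      ... | false = refl
      ... | true  = ⊥-elim (subst T (T-not-≡ .to ¬in-star)
              (T-∧ .from (v∈?S , isSizedSubset⁺ ∣S∣≡1+r (face-∋-⊆ (lookup⇒[]= v S (T-≡ .to v∈?S)) (T-≡ .from ΓS)))))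

  antifacetCount-link+ : Pure Γ → antifacetCount L + (n ∸ 1) C rank L ≤ antifacetCount Γ + ∣ W ∣ C rank L
  antifacetCount-link+ pure = begin
    antifacetCount L + (n ∸ 1) C rank L                        ≡⟨ cong (antifacetCount L +_) countB-leavesStar+ ⟨
    antifacetCount L + (#leaving + ∣ W ∣ C rank L)             ≡⟨ +-assoc (antifacetCount L) #leaving (∣ W ∣ C rank L) ⟨
    antifacetCount L + #leaving + ∣ W ∣ C rank L               ≤⟨ +-monoˡ-≤ (∣ W ∣ C rank L) (+-monoˡ-≤ #leaving antifacetCount-link≤) ⟩
    countB nonFaceInStar ss + #leaving + ∣ W ∣ C rank L        ≤⟨ +-monoˡ-≤ (∣ W ∣ C rank L) (countB-nonFaceInStar+leavesStar≤ pure) ⟩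
    antifacetCount Γ + ∣ W ∣ C rank L                          ∎
    where
    open ≤-Reasoning
    ss = subsets n
    #leaving = countB leavesStar ss

  antifacetCount-link+2*non-neighbours≤ : Pure Γ → 2 ≤ rank L → antifacetCount L + 2 * (n ∸ 1 ∸ ∣ W ∣) ≤ antifacetCount Γ
  antifacetCount-link+2*non-neighbours≤ pure 2≤r = +-cancelʳ-≤ (∣ W ∣ C r) _ _ (begin
    antifacetCount L + 2 * k + ∣ W ∣ C r        ≡⟨ +-assoc (antifacetCount L) (2 * k) (∣ W ∣ C r) ⟩
    antifacetCount L + (2 * k + ∣ W ∣ C r)      ≡⟨ cong (antifacetCount L +_) (+-comm (2 * k) (∣ W ∣ C r)) ⟩
    antifacetCount L + (∣ W ∣ C r + 2 * k)      ≤⟨ +-monoʳ-≤ (antifacetCount L) binomial-growth ⟩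
    antifacetCount L + (n ∸ 1) C r              ≤⟨ antifacetCount-link+ pure ⟩
    antifacetCount Γ + ∣ W ∣ C r                ∎)
    where
    open ≤-Reasoning
    r = rank L
    k = n ∸ 1 ∸ ∣ W ∣
    binomial-growth : ∣ W ∣ C r + 2 * k ≤ (n ∸ 1) C r
    binomial-growth = subst (λ N → ∣ W ∣ C r + 2 * k ≤ N C r) (m+[n∸m]≡n ∣link-vertexSet∣≤n∸1)
      (nCk+2m≤[n+m]Ck k 2≤r rank-link≤∣vertexSet∣)

corollary3p4 : (n : ℕ) (Δ : SimplicialComplex n) → Pure (face Δ) → (v : Fin n)
    → antifacetCount (face Δ) ≤ 2 * codim (face Δ) ∸ 1
    → antifacetCount (link (face Δ) v) ≤ 2 * codim (link (face Δ) v) ∸ 1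
corollary3p4 n Δ pure v ē≤2c∸1 with rank (link (face Δ) v) ≤? 1
... | yes r≤1 = subst (_≤ 2 * codim (link (face Δ) v) ∸ 1) (sym (antifacetCount-link≡0 Δ v r≤1)) z≤n
... | no  r≰1 = +-cancelʳ-≤-∸1 (antifacetCount L) (2 * k) (2 * codim L) (begin
  antifacetCount L + 2 * k        ≤⟨ antifacetCount-link+2*non-neighbours≤ Δ v pure (≰⇒> r≰1) ⟩
  antifacetCount (face Δ)         ≤⟨ ē≤2c∸1 ⟩
  2 * codim (face Δ) ∸ 1          ≡⟨ cong (λ c → 2 * c ∸ 1) (codim≡codim-link+ Δ v pure) ⟩
  2 * (codim L + k) ∸ 1           ≡⟨ cong (_∸ 1) (*-distribˡ-+ 2 (codim L) k) ⟩
  (2 * codim L + 2 * k) ∸ 1       ∎)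
  where
  open ≤-Reasoning
  L = link (face Δ) v
  k = n ∸ 1 ∸ ∣ vertexSet L ∣
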